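{- Every acyclic graph $G$ is $z$-monotonic, i.e., $z(H_1)\ge z(H_2)$ for every induced subgraph $H_1$ of $G$ and every induced subgraph $H_2$ of $H_1$.
   Context: All graphs are finite, undirected, without loops or multiple edges; an acyclic graph is a forest. A $z$-coloring of a graph $G$ is a proper vertex coloring with (nonempty) color classes $C_1,\ldots,C_k$ such that: (i) for any $1\le i<j\le k$, every vertex of color $j$ is adjacent to a vertex of color $i$; (ii) there is a set $\{u_1,\ldots,u_k\}$ of vertices with $u_j\in C_j$ for each $j$, such that $u_k$ is adjacent to $u_j$ for every $j\ne k$; and (iii) for all $i\ne j$, the vertex $u_j$ has a neighbor in $C_i$. $z(G)$ denotes the maximum number of colors used in a $z$-coloring of $G$. -}

module Defs where

open import Data.Nat using (ℕ; suc; _≤_; _<_)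
open import Data.Fin using (Fin; toℕ)
open import Data.Product using (Σ; _×_; ∃)
open import Relation.Binary.PropositionalEquality using (_≡_; _≢_)
open import Relation.Nullary using (¬_)
open import Function.Definitions using (Injective)

record Graph : Set₁ where
  field
    size    : ℕ
    Adj     : Fin size → Fin size → Set
    sym     : ∀ {x y} → Adj x y → Adj y x
    irrefl  : ∀ {x} → ¬ Adj x x
open Graph public

record Cycle (G : Graph) : Set where
  field
    len      : ℕ
    len≥3    : 3 ≤ len
    v        : Fin len → Fin (size G)
    distinct : Injective _≡_ _≡_ v
    step     : ∀ (i j : Fin len) → suc (toℕ i) ≡ toℕ j → Adj G (v i) (v j)
    close    : ∀ (i j : Fin len) → suc (toℕ i) ≡ len → toℕ j ≡ 0 → Adj G (v i) (v j)

Acyclic : Graph → Set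
Acyclic G = ¬ Cycle G

-- H is (isomorphic to) an induced subgraph of G: an injective vertex map
-- that preserves and reflects adjacency.
record InducedSubgraph (H G : Graph) : Set where
  field
    emb       : Fin (size H) → Fin (size G)
    emb-inj   : Injective _≡_ _≡_ emb
    preserves : ∀ {x y} → Adj H x y → Adj G (emb x) (emb y)
    reflects  : ∀ {x y} → Adj G (emb x) (emb y) → Adj H x y

-- A z-coloring of G with k colors, colors C_1..C_k represented as
-- Fin k = {0,…,k-1} in the same order (color i+1 ↦ i).
record ZColoring (G : Graph) (k : ℕ) : Set where
  field
    col    : Fin (size G) → Fin k
    proper : ∀ {x y} → Adj G x y → col x ≢ col y
    grundy : ∀ (x : Fin (size G)) (i : Fin k) → toℕ i < toℕ (col x) →
             ∃ λ y → Adj G x y × col y ≡ i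
    -- (ii) representatives u_j ∈ C_j (this also makes all classes nonempty)
    u      : Fin k → Fin (size G)
    u-col  : ∀ j → col (u j) ≡ j
    u-top  : ∀ (t j : Fin k) → suc (toℕ t) ≡ k → j ≢ t → Adj G (u t) (u j)
    u-nbr  : ∀ (i j : Fin k) → i ≢ j → ∃ λ y → Adj G (u j) y × col y ≡ i

IsZ : Graph → ℕ → Set
IsZ G k = ZColoring G k × (∀ k' → ZColoring G k' → k' ≤ k)

-- Let H₂ be an induced subgraph of the forest H₁, with a z-coloring of k ≥ 2
-- colors, and suppose H₁ had a z-coloring with fewer colors.  The tree T of H₁
-- containing the component C of the top representative u_k in H₂ is recolored:
-- C keeps its H₂ colors (all representatives lie in C, as u_k is adjacent to
-- them), every other vertex of T gets the least color in {0,1} differing from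
-- the color of its parent towards C, and the rest of H₁ keeps its old coloring.
-- Because H₁ is a forest and C is connected, every vertex of T outside C has a
-- unique neighbour closer to C and no neighbour at the same distance, so this
-- is a z-coloring of H₁ with k colors, contradicting the maximality of z(H₁).
module Submission where

open import Defs
open import Data.Nat using (ℕ; zero; suc; _+_; _∸_; _≤_; _<_; _≥_; z≤n; s≤s; pred)
open import Data.Nat.Properties
open import Data.Fin as Fin using (Fin; toℕ; fromℕ; fromℕ<)
import Data.Fin.Properties as Fin
open import Data.Product using (Σ; ∃; _×_; _,_; proj₁; proj₂)
open import Data.Sum using (_⊎_; inj₁; inj₂)
open import Data.Empty using (⊥; ⊥-elim)
open import Data.Unit using (⊤; tt)
open import Function using (_∘_)
open import Relation.Nullary using (¬_; Dec; yes; no; ¬?)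
open import Relation.Nullary.Decidable using (_×-dec_; _⊎-dec_; map′; ¬¬-excluded-middle)
open import Level using (0ℓ)
open import Relation.Unary using (Pred; Decidable; _⊆_)
open import Relation.Binary.Definitions using (tri<; tri≈; tri>)
open import Relation.Binary.PropositionalEquality
  using (_≡_; _≢_; refl; trans; cong; subst; module ≡-Reasoning) renaming (sym to ≡-sym)

mex : ℕ → ℕ
mex zero = 1
mex (suc _) = 0

mex-≢ : ∀ c → mex c ≢ c
mex-≢ zero ()
mex-≢ (suc c) ()

mex≤1 : ∀ c → mex c ≤ 1
mex≤1 zero = ≤-refl
mex≤1 (suc c) = z≤n

<mex⇒≡0 : ∀ {i} c → i < mex c → i ≡ 0 × c ≡ 0
<mex⇒≡0 zero (s≤s z≤n) = refl , refl

-- least P? b is the least n ≤ b with P n, and b if there is none.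
least : {P : Pred ℕ 0ℓ} → Decidable P → ℕ → ℕ
least P? zero = zero
least P? (suc b) with P? zero
... | yes _ = zero
... | no _ = suc (least (P? ∘ suc) b)

least≤ : {P : Pred ℕ 0ℓ} (P? : Decidable P) (b : ℕ) → least P? b ≤ b
least≤ P? zero = z≤n
least≤ P? (suc b) with P? zero
... | yes _ = z≤n
... | no _ = s≤s (least≤ (P? ∘ suc) b)

least-minimal : {P : Pred ℕ 0ℓ} (P? : Decidable P) (b : ℕ) → ∀ {n} → P n → least P? b ≤ n
least-minimal P? zero p = z≤n
least-minimal P? (suc b) {n} p with P? zero | n
... | yes _ | _ = z≤n
... | no ¬p₀ | zero = ⊥-elim (¬p₀ p)
... | no _ | suc n = s≤s (least-minimal (P? ∘ suc) b p)

least-holds : {P : Pred ℕ 0ℓ} (P? : Decidable P) (b : ℕ) → ∀ {n} → n ≤ b → P n → P (least P? b)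
least-holds P? zero z≤n p = p
least-holds P? (suc b) {n} n≤b p with P? zero | n | n≤b
... | yes p₀ | _ | _ = p₀
... | no ¬p₀ | zero | _ = ⊥-elim (¬p₀ p)
... | no _ | suc n | s≤s n≤b′ = least-holds (P? ∘ suc) b n≤b′ p

indicator : {A : Set} → Dec A → ℕ
indicator (yes _) = 1
indicator (no _) = 0

count : ∀ {n} {P : Pred (Fin n) 0ℓ} → Decidable P → ℕ
count {zero} P? = 0
count {suc n} P? = indicator (P? Fin.zero) + count (P? ∘ Fin.suc)

count≤ : ∀ {n} {P : Pred (Fin n) 0ℓ} (P? : Decidable P) → count P? ≤ n
count≤ {zero} P? = z≤n
count≤ {suc n} P? with P? Fin.zero
... | yes _ = s≤s (count≤ (P? ∘ Fin.suc))
... | no _ = m≤n⇒m≤1+n (count≤ (P? ∘ Fin.suc))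

indicator-mono : {A B : Set} (A? : Dec A) (B? : Dec B) → (A → B) → indicator A? ≤ indicator B?
indicator-mono (yes a) (yes _) f = ≤-refl
indicator-mono (yes a) (no ¬b) f = ⊥-elim (¬b (f a))
indicator-mono (no _) B? f = z≤n

count-mono : ∀ {n} {P Q : Pred (Fin n) 0ℓ} (P? : Decidable P) (Q? : Decidable Q) →
             P ⊆ Q → count P? ≤ count Q?
count-mono {zero} P? Q? P⊆Q = z≤n
count-mono {suc n} P? Q? P⊆Q =
  +-mono-≤ (indicator-mono (P? Fin.zero) (Q? Fin.zero) P⊆Q) (count-mono (P? ∘ Fin.suc) (Q? ∘ Fin.suc) P⊆Q)

count-strict : ∀ {n} {P Q : Pred (Fin n) 0ℓ} (P? : Decidable P) (Q? : Decidable Q) →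
               P ⊆ Q → ∀ {x} → Q x → ¬ P x → count P? < count Q?
count-strict P? Q? P⊆Q {Fin.zero} q ¬p with P? Fin.zero | Q? Fin.zero
... | yes p | _ = ⊥-elim (¬p p)
... | no _ | no ¬q = ⊥-elim (¬q q)
... | no _ | yes _ = s≤s (count-mono (P? ∘ Fin.suc) (Q? ∘ Fin.suc) P⊆Q)
count-strict P? Q? P⊆Q {Fin.suc x} q ¬p =
  +-mono-≤-< (indicator-mono (P? Fin.zero) (Q? Fin.zero) P⊆Q)
             (count-strict (P? ∘ Fin.suc) (Q? ∘ Fin.suc) P⊆Q q ¬p)

¬¬-Π-Fin : ∀ n {P : Fin n → Set} → (∀ i → ¬ ¬ P i) → ¬ ¬ (∀ i → P i)
¬¬-Π-Fin zero f k = k λ ()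
¬¬-Π-Fin (suc n) f k = f Fin.zero λ p₀ → ¬¬-Π-Fin n (f ∘ Fin.suc) λ ps →
  k λ { Fin.zero → p₀ ; (Fin.suc i) → ps i }

¬¬-Adj? : (G : Graph) → ¬ ¬ (∀ x y → Dec (Adj G x y))
¬¬-Adj? G = ¬¬-Π-Fin _ λ x → ¬¬-Π-Fin _ λ y → ¬¬-excluded-middle

Vertex : Graph → Set
Vertex G = Fin (size G)

data Walk (G : Graph) : Vertex G → Vertex G → Set where
  [_] : ∀ x → Walk G x x
  step : ∀ x {y z} → Adj G x y → Walk G y z → Walk G x z

module _ {G : Graph} where

  All : (Vertex G → Set) → ∀ {a b} → Walk G a b → Set
  All P [ x ] = P x
  All P (step x _ w) = P x × All P w

  All-map : ∀ {P Q : Vertex G → Set} → P ⊆ Q → ∀ {a b} (w : Walk G a b) → All P w → All Q w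
  All-map f [ x ] p = f p
  All-map f (step x _ w) (p , ps) = f p , All-map f w ps

  All-head : ∀ {P a b} (w : Walk G a b) → All P w → P a
  All-head [ x ] p = p
  All-head (step x _ w) (p , _) = p

  _++_ : ∀ {a b c} → Walk G a b → Walk G b c → Walk G a c
  [ x ] ++ w′ = w′
  step x e w ++ w′ = step x e (w ++ w′)

  All-++ : ∀ {P a b c} (w : Walk G a b) (w′ : Walk G b c) → All P w → All P w′ → All P (w ++ w′)
  All-++ [ x ] w′ _ q = q
  All-++ (step x e w) w′ (p , ps) q = p , All-++ w w′ ps q

  snoc : ∀ {a b c} → Walk G a b → Adj G b c → Walk G a c
  snoc w e = w ++ step _ e [ _ ]

  reverse : ∀ {a b} → Walk G a b → Walk G b a
  reverse [ x ] = [ x ]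
  reverse (step x e w) = snoc (reverse w) (sym G e)

  All-reverse : ∀ {P a b} (w : Walk G a b) → All P w → All P (reverse w)
  All-reverse [ x ] p = p
  All-reverse (step x e w) (p , ps) =
    All-++ (reverse w) (step _ (sym G e) [ x ]) (All-reverse w ps) (All-head w ps , p)

  NonBacktracking : ∀ {a b} → Walk G a b → Set
  NonBacktracking [ x ] = ⊤
  NonBacktracking (step x e [ y ]) = ⊤
  NonBacktracking (step x e (step y {z} e′ w)) = z ≢ x × NonBacktracking (step y e′ w)

  NonBacktracking-tail : ∀ {x y b} (e : Adj G x y) (w : Walk G y b) →
                         NonBacktracking (step x e w) → NonBacktracking w
  NonBacktracking-tail e [ y ] _ = tt
  NonBacktracking-tail e (step y e′ w) (_ , nb) = nb

  NonBacktracking-snoc : ∀ {a b x} (w : Walk G a b) (e : Adj G b x) →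
                         NonBacktracking w → All (_≢ x) w → NonBacktracking (snoc w e)
  NonBacktracking-snoc [ b ] e _ _ = tt
  NonBacktracking-snoc (step a e₁ [ b ]) e _ (a≢x , _) = (λ x≡a → a≢x (≡-sym x≡a)) , tt
  NonBacktracking-snoc (step a e₁ (step c e₂ w)) e (z≢a , nb) (_ , all) =
    z≢a , NonBacktracking-snoc (step c e₂ w) e nb all

  record Reduction {a b} (w : Walk G a b) : Set₁ where
    field
      walk : Walk G a b
      nonBacktracking : NonBacktracking walk
      All-reduced : ∀ (P : Vertex G → Set) → All P w → All P walk

  reduce : ∀ {a b} (w : Walk G a b) → Reduction w
  reduce [ x ] = record { walk = [ x ] ; nonBacktracking = tt ; All-reduced = λ _ p → p }
  reduce (step x e w) = prepend (reduce w)
    where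
    prepend : Reduction w → Reduction (step x e w)
    prepend record { walk = [ y ] ; All-reduced = sub } =
      record { walk = step x e [ y ] ; nonBacktracking = tt ; All-reduced = λ P p → proj₁ p , sub P (proj₂ p) }
    prepend record { walk = step y {z} e′ r ; nonBacktracking = nb ; All-reduced = sub } with z Fin.≟ x
    ... | yes refl =
      record { walk = r ; nonBacktracking = NonBacktracking-tail e′ r nb
             ; All-reduced = λ P p → proj₂ (sub P (proj₂ p)) }
    ... | no z≢x =
      record { walk = step x e (step y e′ r) ; nonBacktracking = z≢x , nb
             ; All-reduced = λ P p → proj₁ p , sub P (proj₂ p) }

  length : ∀ {a b} → Walk G a b → ℕ
  length [ x ] = 0
  length (step x e w) = suc (length w)

  -- The t-th vertex of a walk; positions past the end give its last vertex.
  _at_ : ∀ {a b} → Walk G a b → ℕ → Vertex G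
  [ x ] at _ = x
  step x e w at zero = x
  step x e w at suc t = w at t

  at-zero : ∀ {a b} (w : Walk G a b) → w at 0 ≡ a
  at-zero [ x ] = refl
  at-zero (step x e w) = refl

  at-length : ∀ {a b} (w : Walk G a b) → w at length w ≡ b
  at-length [ x ] = refl
  at-length (step x e w) = at-length w

  at-adjacent : ∀ {a b} (w : Walk G a b) t → t < length w → Adj G (w at t) (w at suc t)
  at-adjacent (step x e [ y ]) zero _ = e
  at-adjacent (step x e (step y e′ w)) zero _ = e
  at-adjacent (step x e w) (suc t) (s≤s t<n) = at-adjacent w t t<n

  at-nonBacktracking : ∀ {a b} (w : Walk G a b) → NonBacktracking w →
                       ∀ t → 2 + t ≤ length w → w at (2 + t) ≢ w at t
  at-nonBacktracking (step x e [ y ]) _ zero (s≤s ())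
  at-nonBacktracking (step x e (step y e′ [ z ])) (z≢x , _) zero _ = z≢x
  at-nonBacktracking (step x e (step y e′ (step z e″ w))) (z≢x , _) zero _ = z≢x
  at-nonBacktracking (step x e (step y e′ w)) (_ , nb) (suc t) (s≤s t<n) =
    at-nonBacktracking (step y e′ w) nb t t<n

module _ {H G : Graph} (E : InducedSubgraph H G) where
  open InducedSubgraph E

  map-walk : ∀ {a b} → Walk H a b → Walk G (emb a) (emb b)
  map-walk [ x ] = [ emb x ]
  map-walk (step x e w) = step (emb x) (preserves e) (map-walk w)

  All-map-walk : ∀ {P : Vertex H → Set} {Q : Vertex G → Set} → (∀ {a} → P a → Q (emb a)) →
                 ∀ {a b} (w : Walk H a b) → All P w → All Q (map-walk w)
  All-map-walk f [ x ] p = f p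
  All-map-walk f (step x e w) (p , ps) = f p , All-map-walk f w ps

  acyclic-induced : Acyclic G → Acyclic H
  acyclic-induced acyclic c = acyclic record
    { len = Cycle.len c ; len≥3 = Cycle.len≥3 c ; v = emb ∘ Cycle.v c
    ; distinct = Cycle.distinct c ∘ emb-inj
    ; step = λ i j e → preserves (Cycle.step c i j e)
    ; close = λ i j e e₀ → preserves (Cycle.close c i j e e₀) }

module _ {G : Graph} (acyclic : Acyclic G) where

  no-closed-injective-sequence :
    (s : ℕ → Vertex G) (m : ℕ) → 0 < m →
    (∀ t → t < m → Adj G (s t) (s (suc t))) → (∀ t → 2 + t ≤ m → s (2 + t) ≢ s t) →
    s 0 ≡ s m → (∀ r r′ → r < r′ → r′ < m → s r ≢ s r′) → ⊥
  no-closed-injective-sequence s 1 _ adj _ closed _ =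
    irrefl G (subst (Adj G (s 0)) (≡-sym closed) (adj 0 ≤-refl))
  no-closed-injective-sequence s 2 _ _ nb closed _ = nb 0 ≤-refl (≡-sym closed)
  no-closed-injective-sequence s m@(suc (suc (suc _))) _ adj _ closed distinct = acyclic record
    { len = m ; len≥3 = s≤s (s≤s (s≤s z≤n)) ; v = s ∘ toℕ
    ; distinct = injective _ _ ; step = consecutive ; close = closing }
    where
    injective : ∀ (r r′ : Fin m) → s (toℕ r) ≡ s (toℕ r′) → r ≡ r′
    injective r r′ eq with <-cmp (toℕ r) (toℕ r′)
    ... | tri< r<r′ _ _ = ⊥-elim (distinct _ _ r<r′ (Fin.toℕ<n r′) eq)
    ... | tri≈ _ r≡r′ _ = Fin.toℕ-injective r≡r′
    ... | tri> _ _ r>r′ = ⊥-elim (distinct _ _ r>r′ (Fin.toℕ<n r) (≡-sym eq))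
    consecutive : ∀ (i j : Fin m) → suc (toℕ i) ≡ toℕ j → Adj G (s (toℕ i)) (s (toℕ j))
    consecutive i j eq rewrite ≡-sym eq = adj (toℕ i) (Fin.toℕ<n i)
    closing : ∀ (i j : Fin m) → suc (toℕ i) ≡ m → toℕ j ≡ 0 → Adj G (s (toℕ i)) (s (toℕ j))
    closing i j eq j≡0 rewrite j≡0 =
      subst (Adj G (s (toℕ i))) (trans (cong s eq) (≡-sym closed)) (adj (toℕ i) (Fin.toℕ<n i))

  -- The first vertex repeating an earlier one closes a cycle.
  no-closed-nonBacktracking-sequence :
    (s : ℕ → Vertex G) (L : ℕ) → 0 < L →
    (∀ t → t < L → Adj G (s t) (s (suc t))) → (∀ t → 2 + t ≤ L → s (2 + t) ≢ s t) →
    s 0 ≡ s L → ⊥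
  no-closed-nonBacktracking-sequence s L 0<L adj nb closed =
    no-closed-injective-sequence (s ∘ (i +_)) m 0<m adj′ nb′ closed′ distinct
    where
    Repeated : ℕ → Set
    Repeated j = ∃ λ i → i < j × s i ≡ s j
    Repeated? : Decidable Repeated
    Repeated? j = anyUpTo? (λ i → s i Fin.≟ s j) j
    j = least Repeated? L
    j≤L : j ≤ L
    j≤L = least≤ Repeated? L
    repeat : Repeated j
    repeat = least-holds Repeated? L ≤-refl (0 , 0<L , closed)
    i = proj₁ repeat
    i<j = proj₁ (proj₂ repeat)
    m = j ∸ i
    i+m≡j : i + m ≡ j
    i+m≡j = m+[n∸m]≡n (<⇒≤ i<j)
    0<m : 0 < m
    0<m = m<n⇒0<n∸m i<j
    shifted< : ∀ {r} → r < m → i + r < j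
    shifted< {r} r<m = subst (i + r <_) i+m≡j (+-monoʳ-< i r<m)
    adj′ : ∀ t → t < m → Adj G (s (i + t)) (s (i + suc t))
    adj′ t t<m rewrite +-suc i t = adj (i + t) (<-≤-trans (shifted< t<m) j≤L)
    nb′ : ∀ t → 2 + t ≤ m → s (i + (2 + t)) ≢ s (i + t)
    nb′ t 2+t≤m rewrite +-suc i (suc t) | +-suc i t =
      nb (i + t) (subst (_≤ L) (cong suc (+-suc i t)) (≤-trans (shifted< 2+t≤m) j≤L))
    closed′ : s (i + 0) ≡ s (i + m)
    closed′ = trans (cong s (+-identityʳ i)) (trans (proj₂ (proj₂ repeat)) (cong s (≡-sym i+m≡j)))
    distinct : ∀ r r′ → r < r′ → r′ < m → s (i + r) ≢ s (i + r′)
    distinct r r′ r<r′ r′<m eq = <⇒≱ (shifted< r′<m)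
      (least-minimal Repeated? L (i + r , +-monoʳ-< i r<r′ , eq))

  no-closed-nonBacktracking-walk : ∀ {x} (w : Walk G x x) → NonBacktracking w → 0 < length w → ⊥
  no-closed-nonBacktracking-walk w nb 0<len =
    no-closed-nonBacktracking-sequence (w at_) (length w) 0<len (at-adjacent w) (at-nonBacktracking w nb)
      (trans (at-zero w) (≡-sym (at-length w)))

  no-cycle-through : ∀ {a b x} (w : Walk G a b) → NonBacktracking w → a ≢ b → All (_≢ x) w →
                     Adj G x a → Adj G b x → ⊥
  no-cycle-through [ a ] _ a≢a _ _ _ = a≢a refl
  no-cycle-through {x = x} (step a e₁ w) nb _ avoids e e′ =
    no-closed-nonBacktracking-walk (step x e (snoc (step a e₁ w) e′))
      (All-head w (proj₂ avoids) , NonBacktracking-snoc (step a e₁ w) e′ nb avoids) (s≤s z≤n)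

  -- Every walk contains a non-backtracking one with the same ends.
  no-cycle-through-walk : ∀ {a b x} (w : Walk G a b) → a ≢ b → All (_≢ x) w →
                          Adj G x a → Adj G b x → ⊥
  no-cycle-through-walk {x = x} w a≢b avoids =
    no-cycle-through walk nonBacktracking a≢b (All-reduced (_≢ x) avoids)
    where open Reduction (reduce w)

module Reachability (G : Graph) (Adj? : ∀ x y → Dec (Adj G x y))
                    (S : Pred (Vertex G) 0ℓ) (S? : Decidable S) where

  N : ℕ
  N = size G

  -- Within n x: x is at distance at most n from S.
  Within : ℕ → Pred (Vertex G) 0ℓ
  Within zero = S
  Within (suc n) x = Within n x ⊎ ∃ λ y → Within n y × Adj G x y

  Within? : ∀ n → Decidable (Within n)
  Within? zero = S?
  Within? (suc n) x = Within? n x ⊎-dec Fin.any? (λ y → Within? n y ×-dec Adj? x y)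

  Within-mono : ∀ {m n} → m ≤ n → Within m ⊆ Within n
  Within-mono {m} {n} m≤n w with m≤n⇒m<n∨m≡n m≤n
  ... | inj₂ refl = w
  Within-mono {n = suc n} _ w | inj₁ m<1+n = inj₁ (Within-mono (≤-pred m<1+n) w)

  Stable : ℕ → Set
  Stable m = Within (suc m) ⊆ Within m

  stable-forever : ∀ {m} → Stable m → ∀ k → Within (k + m) ⊆ Within m
  stable-forever st zero w = w
  stable-forever st (suc k) (inj₁ w) = stable-forever st k w
  stable-forever st (suc k) (inj₂ (y , w , e)) = st (inj₂ (y , stable-forever st k w , e))

  stabilises-or-grows : ∀ n → (∃ λ m → m < n × Stable m) ⊎ n ≤ count (Within? n)
  stabilises-or-grows zero = inj₂ z≤n
  stabilises-or-grows (suc n) with stabilises-or-grows n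
  ... | inj₁ (m , m<n , st) = inj₁ (m , m≤n⇒m≤1+n m<n , st)
  ... | inj₂ n≤count with Fin.any? (λ x → Within? (suc n) x ×-dec ¬? (Within? n x))
  ...   | yes (x , new , ¬old) =
          inj₂ (≤-trans (s≤s n≤count) (count-strict (Within? n) (Within? (suc n)) inj₁ new ¬old))
  ...   | no ¬new = inj₁ (n , ≤-refl , stable)
          where
          stable : Stable n
          stable {x} w with Within? n x
          ... | yes old = old
          ... | no ¬old = ⊥-elim (¬new (x , w , ¬old))

  stabilises : ∃ λ m → m ≤ N × Stable m
  stabilises with stabilises-or-grows (suc N)
  ... | inj₁ (m , m<1+N , st) = m , ≤-pred m<1+N , st
  ... | inj₂ 1+N≤count = ⊥-elim (<⇒≱ 1+N≤count (count≤ (Within? (suc N))))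

  Reached : Pred (Vertex G) 0ℓ
  Reached = Within N

  Reached? : Decidable Reached
  Reached? = Within? N

  Within⇒Reached : ∀ n → Within n ⊆ Reached
  Within⇒Reached n w with stabilises
  ... | m , m≤N , st = Within-mono m≤N (stable-forever st n (Within-mono (m≤m+n n m) w))

  Reached-closed : ∀ {x y} → Reached x → Adj G x y → Reached y
  Reached-closed {x} r e = Within⇒Reached (suc N) (inj₂ (x , r , sym G e))

  walk-to-S : ∀ n {x} → Within n x → ∃ λ s → S s × Σ (Walk G x s) (All (Within n))
  walk-to-S zero {x} s = x , s , [ x ] , s
  walk-to-S (suc n) (inj₁ w) with walk-to-S n w
  ... | s , s∈S , v , all = s , s∈S , v , All-map inj₁ v all
  walk-to-S (suc n) {x} (inj₂ (y , w , e)) with walk-to-S n w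
  ... | s , s∈S , v , all = s , s∈S , step x e v , inj₂ (y , w , e) , All-map inj₁ v all

  module _ (S-connected : ∀ {s s′} → S s → S s′ → Σ (Walk G s s′) (All S)) where

    Within-connected : ∀ n {x y} → Within n x → Within n y → Σ (Walk G x y) (All (Within n))
    Within-connected n wx wy with walk-to-S n wx | walk-to-S n wy
    ... | s , s∈S , vx , ax | s′ , s′∈S , vy , ay with S-connected s∈S s′∈S
    ... | v , av = vx ++ (v ++ reverse vy) ,
                   All-++ vx _ ax (All-++ v _ (All-map (Within-mono z≤n) v av) (All-reverse vy ay))

  dist : Vertex G → ℕ
  dist x = least (λ n → Within? n x) N

  dist-within : ∀ {x} → Reached x → Within (dist x) x
  dist-within r = least-holds (λ n → Within? n _) N ≤-refl r

  dist-least : ∀ {n x} → Within n x → dist x ≤ n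
  dist-least = least-minimal (λ n → Within? n _) N

  S⇒dist≡0 : ∀ {x} → S x → dist x ≡ 0
  S⇒dist≡0 s = n≤0⇒n≡0 (dist-least {0} s)

  dist≡0⇒S : ∀ {x} → Reached x → dist x ≡ 0 → S x
  dist≡0⇒S {x} r d = subst (λ n → Within n x) d (dist-within r)

  dist-suc : ∀ {x} → Reached x → ¬ S x → ∃ λ n → dist x ≡ suc n
  dist-suc {x} r ¬s with dist x in eq
  ... | zero = ⊥-elim (¬s (dist≡0⇒S r eq))
  ... | suc n = n , refl

  -- A neighbour one step closer to S (or x itself when x is in S or unreached).
  parent : Vertex G → Vertex G
  parent x with Fin.any? (λ y → Within? (pred (dist x)) y ×-dec Adj? x y)
  ... | yes (y , _) = y
  ... | no _ = x

  parent-within : ∀ {x n} → Reached x → dist x ≡ suc n → Adj G x (parent x) × Within n (parent x)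
  parent-within {x} {n} r d with Fin.any? (λ y → Within? (pred (dist x)) y ×-dec Adj? x y)
  ... | yes (y , w , e) = e , subst (λ m → Within (pred m) y) d w
  ... | no none with subst (λ m → Within m x) d (dist-within r)
  ...   | inj₁ w = ⊥-elim (<-irrefl d (s≤s (dist-least w)))
  ...   | inj₂ (y , w , e) = ⊥-elim (none (y , subst (λ m → Within (pred m) y) (≡-sym d) w , e))

  parent-adjacent : ∀ {x n} → Reached x → dist x ≡ suc n → Adj G x (parent x)
  parent-adjacent r d = proj₁ (parent-within r d)

  parent-reached : ∀ {x n} → Reached x → dist x ≡ suc n → Reached (parent x)
  parent-reached r d = Reached-closed r (parent-adjacent r d)

  dist-parent : ∀ {x n} → Reached x → dist x ≡ suc n → dist (parent x) ≡ n
  dist-parent {x} {n} r d = ≤-antisym (dist-least (proj₂ (parent-within r d))) n≤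
    where
    n≤ : n ≤ dist (parent x)
    n≤ = ≮⇒≥ λ closer → <-irrefl d (≤-<-trans
      (dist-least (inj₂ (parent x , dist-within (parent-reached r d) , parent-adjacent r d))) (s≤s closer))

  module Forest (acyclic : Acyclic G) (S-connected : ∀ {s s′} → S s → S s′ → Σ (Walk G s s′) (All S)) where

    -- Neighbours of a vertex x at distance n + 1 are joined through vertices within
    -- distance n of S, hence avoiding x, which closes a cycle through x.
    private
      farther-than-within : ∀ {n x} → dist x ≡ suc n → ∀ {v} → Within n v → v ≢ x
      farther-than-within d w refl = <-irrefl d (s≤s (dist-least w))

    parent-unique : ∀ {x y n} → Reached x → dist x ≡ suc n → Adj G x y → Within n y → y ≡ parent x
    parent-unique {x} {y} {n} r d e w with y Fin.≟ parent x
    ... | yes y≡p = y≡p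
    ... | no y≢p with Within-connected S-connected n w (proj₂ (parent-within r d))
    ...   | v , all = ⊥-elim (no-cycle-through-walk acyclic v y≢p
              (All-map (farther-than-within d) v all) e (sym G (parent-adjacent r d)))

    no-edge-within-level : ∀ {x y n} → Reached x → Reached y → Adj G x y →
                           dist x ≡ suc n → dist y ≡ suc n → ⊥
    no-edge-within-level {x} {y} {n} rx ry e dx dy
      with Within-connected S-connected n (proj₂ (parent-within ry dy)) (proj₂ (parent-within rx dx))
    ... | v , all = no-cycle-through-walk acyclic (step y (parent-adjacent ry dy) v) y≢px
          ((λ { refl → irrefl G e }) , All-map (farther-than-within dx) v all) e (sym G (parent-adjacent rx dx))
      where
      y≢px : y ≢ parent x
      y≢px refl = 1+n≢n (trans (≡-sym dy) (dist-parent rx dx))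

    adjacent-levels : ∀ {x y} → Reached x → Reached y → Adj G x y → ¬ (S x × S y) →
                      dist y ≡ suc (dist x) ⊎ dist x ≡ suc (dist y)
    adjacent-levels {x} {y} rx ry e ¬both with <-cmp (dist x) (dist y)
    ... | tri< lt _ _ = inj₁ (≤-antisym (dist-least (inj₂ (x , dist-within rx , sym G e))) lt)
    ... | tri> _ _ gt = inj₂ (≤-antisym (dist-least (inj₂ (y , dist-within ry , e))) gt)
    ... | tri≈ _ eq _ with dist x in dx
    ...   | zero = ⊥-elim (¬both (dist≡0⇒S rx dx , dist≡0⇒S ry (≡-sym eq)))
    ...   | suc n = ⊥-elim (no-edge-within-level rx ry e dx (≡-sym eq))

    parent-of-child : ∀ {x y} → Reached y → Adj G x y → dist y ≡ suc (dist x) → parent y ≡ x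
    parent-of-child ry e d =
      ≡-sym (parent-unique ry d (sym G e) (dist-within (Reached-closed ry (sym G e))))

module Extension {H₁ H₂ : Graph} (acyclic : Acyclic H₁) (E : InducedSubgraph H₂ H₁)
                 (Adj? : ∀ x y → Dec (Adj H₁ x y))
                 {k z : ℕ} (Z₂ : ZColoring H₂ (2 + k)) (Z₁ : ZColoring H₁ z) (z≤ : z ≤ 2 + k) where
  open InducedSubgraph E
  module Z₁ = ZColoring Z₁
  module Z₂ = ZColoring Z₂

  Adj₂? : ∀ a b → Dec (Adj H₂ a b)
  Adj₂? a b = map′ reflects preserves (Adj? (emb a) (emb b))

  root : Vertex H₂
  root = Z₂.u (fromℕ (suc k))

  module C = Reachability H₂ Adj₂? (_≡ root) (Fin._≟ root)

  representative-in-component : ∀ j → C.Reached (Z₂.u j)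
  representative-in-component j with j Fin.≟ fromℕ (suc k)
  ... | yes refl = C.Within⇒Reached 0 refl
  ... | no j≢top = C.Reached-closed (C.Within⇒Reached 0 refl)
                     (Z₂.u-top _ j (cong suc (Fin.toℕ-fromℕ (suc k))) j≢top)

  Seed : Pred (Vertex H₁) 0ℓ
  Seed x = ∃ λ a → emb a ≡ x × C.Reached a

  Seed? : Decidable Seed
  Seed? x = Fin.any? (λ a → (emb a Fin.≟ x) ×-dec C.Reached? a)

  root-connected : ∀ {s s′} → s ≡ root → s′ ≡ root → Σ (Walk H₂ s s′) (All (_≡ root))
  root-connected refl refl = [ root ] , refl

  Seed-connected : ∀ {s s′} → Seed s → Seed s′ → Σ (Walk H₁ s s′) (All Seed)
  Seed-connected (a , refl , ra) (b , refl , rb) with C.Within-connected root-connected C.N ra rb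
  ... | v , all = map-walk E v , All-map-walk E (λ r → _ , refl , r) v all

  open Reachability H₁ Adj? Seed Seed?
  open Forest acyclic Seed-connected

  seed-colour : Vertex H₁ → ℕ
  seed-colour x with Seed? x
  ... | yes (a , _) = toℕ (Z₂.col a)
  ... | no _ = 0

  seed-colour-emb : ∀ {a} → C.Reached a → seed-colour (emb a) ≡ toℕ (Z₂.col a)
  seed-colour-emb {a} r with Seed? (emb a)
  ... | yes (b , eb≡ea , _) = cong (toℕ ∘ Z₂.col) (emb-inj eb≡ea)
  ... | no ¬seed = ⊥-elim (¬seed (a , refl , r))

  -- tree-colour n x is the colour of a vertex x with dist x ≡ n.
  tree-colour : ℕ → Vertex H₁ → ℕ
  tree-colour zero x = seed-colour x
  tree-colour (suc n) x = mex (tree-colour n (parent x))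

  colour : Vertex H₁ → ℕ
  colour x with Reached? x
  ... | yes _ = tree-colour (dist x) x
  ... | no _ = toℕ (Z₁.col x)

  colour-reached : ∀ {x} → Reached x → colour x ≡ tree-colour (dist x) x
  colour-reached {x} r with Reached? x
  ... | yes _ = refl
  ... | no ¬r = ⊥-elim (¬r r)

  colour-unreached : ∀ {x} → ¬ Reached x → colour x ≡ toℕ (Z₁.col x)
  colour-unreached {x} ¬r with Reached? x
  ... | yes r = ⊥-elim (¬r r)
  ... | no _ = refl

  colour-seed : ∀ {a} → C.Reached a → colour (emb a) ≡ toℕ (Z₂.col a)
  colour-seed {a} r = begin
    colour (emb a)                           ≡⟨ colour-reached reached ⟩
    tree-colour (dist (emb a)) (emb a)       ≡⟨ cong (λ n → tree-colour n (emb a)) (S⇒dist≡0 seed) ⟩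
    seed-colour (emb a)                      ≡⟨ seed-colour-emb r ⟩
    toℕ (Z₂.col a)                           ∎
    where
    open ≡-Reasoning
    seed : Seed (emb a)
    seed = a , refl , r
    reached : Reached (emb a)
    reached = Within⇒Reached 0 seed

  colour-parent : ∀ {x n} → Reached x → dist x ≡ suc n → colour x ≡ mex (colour (parent x))
  colour-parent {x} {n} r d = begin
    colour x                                 ≡⟨ colour-reached r ⟩
    tree-colour (dist x) x                   ≡⟨ cong (λ m → tree-colour m x) d ⟩
    mex (tree-colour n (parent x))           ≡⟨ cong (λ m → mex (tree-colour m (parent x))) (dist-parent r d) ⟨
    mex (tree-colour (dist (parent x)) (parent x)) ≡⟨ cong mex (colour-reached (parent-reached r d)) ⟨
    mex (colour (parent x))                  ∎
    where open ≡-Reasoning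

  seed-colour< : ∀ x → seed-colour x < 2 + k
  seed-colour< x with Seed? x
  ... | yes (a , _) = Fin.toℕ<n (Z₂.col a)
  ... | no _ = s≤s z≤n

  tree-colour< : ∀ n x → tree-colour n x < 2 + k
  tree-colour< zero = seed-colour<
  tree-colour< (suc n) x = s≤s (≤-trans (mex≤1 _) (s≤s z≤n))

  colour< : ∀ x → colour x < 2 + k
  colour< x with Reached? x
  ... | yes _ = tree-colour< (dist x) x
  ... | no _ = <-≤-trans (Fin.toℕ<n (Z₁.col x)) z≤

  colour-child : ∀ {x y} → Reached y → Adj H₁ x y → dist y ≡ suc (dist x) → colour y ≡ mex (colour x)
  colour-child ry e d = trans (colour-parent ry d) (cong (mex ∘ colour) (parent-of-child ry e d))

  colour-proper-reached : ∀ {x y} → Reached x → Reached y → Adj H₁ x y → colour x ≢ colour y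
  colour-proper-reached {x} {y} rx ry e with Seed? x ×-dec Seed? y
  ... | yes ((a , refl , ra) , (b , refl , rb)) = λ eq → Z₂.proper (reflects e) (Fin.toℕ-injective
        (trans (≡-sym (colour-seed ra)) (trans eq (colour-seed rb))))
  ... | no ¬both with adjacent-levels rx ry e ¬both
  ...   | inj₁ d = λ eq → mex-≢ (colour x) (≡-sym (trans eq (colour-child ry e d)))
  ...   | inj₂ d = λ eq → mex-≢ (colour y) (≡-sym (trans (≡-sym eq) (colour-child rx (sym H₁ e) d)))

  colour-proper : ∀ {x y} → Adj H₁ x y → colour x ≢ colour y
  colour-proper {x} {y} e = cases (Reached? x) (Reached? y)
    where
    cases : Dec (Reached x) → Dec (Reached y) → colour x ≢ colour y
    cases (yes rx) (yes ry) = colour-proper-reached rx ry e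
    cases (yes rx) (no ¬ry) = ⊥-elim (¬ry (Reached-closed rx e))
    cases (no ¬rx) (yes ry) = ⊥-elim (¬rx (Reached-closed ry (sym H₁ e)))
    cases (no ¬rx) (no ¬ry) eq = Z₁.proper e (Fin.toℕ-injective
      (trans (≡-sym (colour-unreached ¬rx)) (trans eq (colour-unreached ¬ry))))

  grundy-seed : ∀ {a} (i : Fin (2 + k)) → C.Reached a → toℕ i < colour (emb a) →
                ∃ λ y → Adj H₁ (emb a) y × colour y ≡ toℕ i
  grundy-seed {a} i ra i< with Z₂.grundy a i (subst (toℕ i <_) (colour-seed ra) i<)
  ... | b , e , cb≡i = emb b , preserves e , trans (colour-seed (C.Reached-closed ra e)) (cong toℕ cb≡i)

  grundy-unreached : ∀ {x} (i : Fin (2 + k)) → ¬ Reached x → toℕ i < colour x →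
                     ∃ λ y → Adj H₁ x y × colour y ≡ toℕ i
  grundy-unreached {x} i ¬rx i<
    with Z₁.grundy x (fromℕ< i<z) (subst (_< toℕ (Z₁.col x)) (≡-sym (Fin.toℕ-fromℕ< i<z)) i<′)
    where
    i<′ : toℕ i < toℕ (Z₁.col x)
    i<′ = subst (toℕ i <_) (colour-unreached ¬rx) i<
    i<z : toℕ i < z
    i<z = <-trans i<′ (Fin.toℕ<n (Z₁.col x))
  ... | y , e , cy≡i = y , e , trans (colour-unreached λ ry → ¬rx (Reached-closed ry (sym H₁ e)))
                                     (trans (cong toℕ cy≡i) (Fin.toℕ-fromℕ< _))

  colour-grundy : ∀ x (i : Fin (2 + k)) → toℕ i < colour x → ∃ λ y → Adj H₁ x y × colour y ≡ toℕ i
  colour-grundy x i i< = cases (Reached? x)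
    where
    cases : Dec (Reached x) → ∃ λ y → Adj H₁ x y × colour y ≡ toℕ i
    cases (no ¬rx) = grundy-unreached i ¬rx i<
    cases (yes rx) with Seed? x
    ... | yes (a , refl , ra) = grundy-seed i ra i<
    ... | no ¬seed with dist-suc rx ¬seed
    ...   | n , d with <mex⇒≡0 (colour (parent x)) (subst (toℕ i <_) (colour-parent rx d) i<)
    ...     | i≡0 , c≡0 = parent x , parent-adjacent rx d , trans c≡0 (≡-sym i≡0)

  col : Vertex H₁ → Fin (2 + k)
  col x = fromℕ< (colour< x)

  toℕ-col : ∀ x → toℕ (col x) ≡ colour x
  toℕ-col x = Fin.toℕ-fromℕ< (colour< x)

  col-≡ : ∀ {x} {i : Fin (2 + k)} → colour x ≡ toℕ i → col x ≡ i
  col-≡ eq = Fin.toℕ-injective (trans (toℕ-col _) eq)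

  col-seed : ∀ {a} → C.Reached a → ∀ {i} → Z₂.col a ≡ i → col (emb a) ≡ i
  col-seed r refl = col-≡ (colour-seed r)

  extension : ZColoring H₁ (2 + k)
  extension = record
    { col = col
    ; proper = λ e eq → colour-proper e (trans (≡-sym (toℕ-col _)) (trans (cong toℕ eq) (toℕ-col _)))
    ; grundy = λ x i i< → let (y , e , c) = colour-grundy x i (subst (toℕ i <_) (toℕ-col x) i<)
                          in y , e , col-≡ c
    ; u = emb ∘ Z₂.u
    ; u-col = λ j → col-seed (representative-in-component j) (Z₂.u-col j)
    ; u-top = λ t j e j≢t → preserves (Z₂.u-top t j e j≢t)
    ; u-nbr = λ i j i≢j → let (y , e , c) = Z₂.u-nbr i j i≢j
                          in emb y , preserves e , col-seed (C.Reached-closed (representative-in-component j) e) c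
    }

lift-ZColoring : ∀ {H₁ H₂ z₁ z₂} → Acyclic H₁ → InducedSubgraph H₂ H₁ →
                 (∀ x y → Dec (Adj H₁ x y)) →
                 ZColoring H₁ z₁ → ZColoring H₂ z₂ → z₁ < z₂ → ZColoring H₁ z₂
lift-ZColoring {z₂ = zero} _ _ _ _ _ ()
lift-ZColoring {z₁ = suc _} {z₂ = 1} _ _ _ _ _ (s≤s ())
lift-ZColoring {z₁ = zero} {z₂ = 1} _ E _ Z₁ Z₂ _
  with ZColoring.col Z₁ (InducedSubgraph.emb E (ZColoring.u Z₂ Fin.zero))
... | ()
lift-ZColoring {z₂ = suc (suc k)} acyclic E Adj? Z₁ Z₂ z₁<z₂ =
  Extension.extension acyclic E Adj? Z₂ Z₁ (<⇒≤ z₁<z₂)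

proposition4 : (G : Graph) → Acyclic G →
    (H₁ H₂ : Graph) → InducedSubgraph H₁ G → InducedSubgraph H₂ H₁ →
    (z₁ z₂ : ℕ) → IsZ H₁ z₁ → IsZ H₂ z₂ → z₁ ≥ z₂
-- Adjacency is not assumed decidable, but since the goal is, classical reasoning about it is allowed.
proposition4 G acyclic H₁ H₂ H₁⊆G H₂⊆H₁ z₁ z₂ (Z₁ , maximal₁) (Z₂ , _) =
  ≮⇒≥ λ z₁<z₂ → ¬¬-Adj? H₁ λ Adj? →
    <⇒≱ z₁<z₂ (maximal₁ z₂
      (lift-ZColoring (acyclic-induced H₁⊆G acyclic) H₂⊆H₁ Adj? Z₁ Z₂ z₁<z₂))
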